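{- If a simply connected dimer model $\widetilde Q$ is weakly consistent, then it has a perfect matching.
   Context: A dimer model is a quiver with faces $Q=(Q_0,Q_1,Q_2)$, $Q_2=Q_2^{cc}\sqcup Q_2^{cl}$ a set of cycles (faces), such that every arrow lies in one face (boundary) or two faces (internal), each internal arrow lies in one face of $Q_2^{cc}$ and one of $Q_2^{cl}$, incidence graphs at vertices are connected, and every vertex has finitely many incident arrows (the model may be infinite). Gluing polygons gives a surface $S(Q)$; $Q$ is simply connected if $S(Q)$ is. For internal $\alpha$, $R_\alpha^{cc},R_\alpha^{cl}$ are the paths from $h(\alpha)$ to $t(\alpha)$ around the two faces containing $\alpha$, and $A_Q=\mathbb CQ/\langle R_\alpha^{cc}-R_\alpha^{cl}\rangle$. $Q$ is weakly consistent if $S(Q)$ is not a sphere and $Q$ is path-consistent: for all vertices $v_1,v_2$ and homotopy classes $C$ of paths from $v_1$ to $v_2$ there is a minimal path $r\in C$ (no face-path can be factored out of its class in $A_Q$), unique up to equality in $A_Q$, such that every path in $C$ equals in $A_Q$ the composition of $r$ with a unique number $m\ge0$ of face-paths (cycles going once around a face). A perfect matching of $Q$ is a set of arrows containing exactly one arrow of every face. -}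

module Defs where

open import Data.Nat using (ℕ)
open import Data.Bool using (Bool; true; false; not)
open import Data.List using (List; []; _∷_; _++_; concat; length; map; reverse)
open import Data.List.Membership.Propositional using (_∈_)
open import Data.List.Relation.Unary.All using (All)
open import Data.List.Relation.Unary.Unique.Propositional using (Unique)
open import Data.Product using (Σ; ∃; ∃-syntax; _×_; _,_)
open import Data.Sum using (_⊎_; inj₁; inj₂)
open import Data.Unit using (⊤)
open import Data.Empty using (⊥)
open import Relation.Nullary using (¬_)
open import Relation.Binary.PropositionalEquality using (_≡_; _≢_)
open import Relation.Binary.Construct.Closure.Equivalence using (EqClosure)

-- Faces are given by their boundary cycle, a list of arrows in cyclic order
-- (the list is a cycle: consecutive arrows compose, and the last composes
-- with the first; this is required in IsDimerModel).
record QuiverWithFaces : Set₁ where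
  field
    Q₀   : Set
    Q₁   : Set
    t    : Q₁ → Q₀
    h    : Q₁ → Q₀
    Q₂cc : Set
    Q₂cl : Set
    ∂cc  : Q₂cc → List Q₁
    ∂cl  : Q₂cl → List Q₁

module _ (Q : QuiverWithFaces) where
  open QuiverWithFaces Q

  Face : Set
  Face = Q₂cc ⊎ Q₂cl

  ∂ : Face → List Q₁
  ∂ (inj₁ f) = ∂cc f
  ∂ (inj₂ f) = ∂cl f

  data IsPath : Q₀ → List Q₁ → Q₀ → Set where
    nil  : ∀ {v} → IsPath v [] v
    cons : ∀ {w} a {p} → IsPath (h a) p w → IsPath (t a) (a ∷ p) w

  Rot : List Q₁ → List Q₁ → Set
  Rot l l' = ∃[ xs ] ∃[ ys ] (l ≡ xs ++ ys × l' ≡ ys ++ xs)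

  IsCycle : List Q₁ → Set
  IsCycle l = l ≢ [] × ∃[ v ] IsPath v l v

  Consec : Face → Q₁ → Q₁ → Set
  Consec f α β = ∃[ r ] ∃[ s ] (Rot (∂ f) (α ∷ r) × r ++ α ∷ [] ≡ β ∷ s)

  -- incidence graph at v: nodes are incoming (inj₁) and outgoing (inj₂) arrows at v;
  -- an incoming α is joined to an outgoing β if β follows α in some face
  Inc : Q₀ → Set
  Inc v = (Σ Q₁ λ α → h α ≡ v) ⊎ (Σ Q₁ λ α → t α ≡ v)

  IncEdge : (v : Q₀) → Inc v → Inc v → Set
  IncEdge v (inj₁ (α , _)) (inj₂ (β , _)) = ∃[ f ] Consec f α β
  IncEdge v _ _ = ⊥

  Internal : Q₁ → Set
  Internal α = (∃[ f ] α ∈ ∂cc f) × (∃[ g ] α ∈ ∂cl g)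

  record IsDimerModel : Set where
    field
      face-cycle   : ∀ f → IsCycle (∂ f) × Unique (∂ f)
      in-some-face : ∀ α → ∃[ f ] α ∈ ∂ f
      cc-unique    : ∀ α (f g : Q₂cc) → α ∈ ∂cc f → α ∈ ∂cc g → f ≡ g
      cl-unique    : ∀ α (f g : Q₂cl) → α ∈ ∂cl f → α ∈ ∂cl g → f ≡ g
      inc-connected : ∀ v (x y : Inc v) → EqClosure (IncEdge v) x y
      locally-finite : ∀ v → ∃[ L ] (∀ α → (t α ≡ v ⊎ h α ≡ v) → α ∈ L)

  -- The relations of A_Q: for internal α, R^cc_α and R^cl_α are the
  -- remaining arrows of the cc / cl face containing α, read from h α.
  RelPair : List Q₁ → List Q₁ → Set
  RelPair r s = ∃[ α ] ∃[ f ] ∃[ g ] (Rot (∂cc f) (α ∷ r) × Rot (∂cl g) (α ∷ s))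

  AStep : List Q₁ → List Q₁ → Set
  AStep p q = ∃[ x ] ∃[ y ] ∃[ r ] ∃[ s ]
                (RelPair r s × p ≡ x ++ r ++ y × q ≡ x ++ s ++ y)

  _≈A_ : List Q₁ → List Q₁ → Set
  _≈A_ = EqClosure AStep

  FacePath : List Q₁ → Set
  FacePath F = ∃[ f ] Rot (∂ f) F

  FacePathAt : Q₀ → List Q₁ → Set
  FacePathAt v F = FacePath F × IsPath v F v

  Minimal : List Q₁ → Set
  Minimal r = ¬ (∃[ x ] ∃[ F ] ∃[ y ] (FacePath F × r ≈A (x ++ F ++ y)))

  Step : Set
  Step = Q₁ × Bool     -- true: traverse α forwards, false: backwards

  data IsWalk : Q₀ → List Step → Q₀ → Set where
    nil  : ∀ {v} → IsWalk v [] v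
    fwd  : ∀ {w} a {p} → IsWalk (h a) p w → IsWalk (t a) ((a , true) ∷ p) w
    bwd  : ∀ {w} a {p} → IsWalk (t a) p w → IsWalk (h a) ((a , false) ∷ p) w

  flipStep : Step → Step
  flipStep (a , b) = (a , not b)

  inverseWalk : List Step → List Step
  inverseWalk w = reverse (map flipStep w)

  asWalk : List Q₁ → List Step
  asWalk = map (λ a → (a , true))

  HStep : List Step → List Step → Set
  HStep p q =
    (∃[ x ] ∃[ y ] ∃[ a ] ∃[ b ] (p ≡ x ++ (a , b) ∷ (a , not b) ∷ y × q ≡ x ++ y))
    ⊎ (∃[ x ] ∃[ y ] ∃[ F ] (FacePath F × p ≡ x ++ asWalk F ++ y × q ≡ x ++ y))
    ⊎ (∃[ x ] ∃[ y ] ∃[ F ] (FacePath F × p ≡ x ++ inverseWalk (asWalk F) ++ y × q ≡ x ++ y))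

  Homotopic : List Step → List Step → Set
  Homotopic = EqClosure HStep

  SimplyConnected : Set
  SimplyConnected =
    Σ Q₀ (λ _ → ⊤)
    × (∀ u v → ∃[ w ] IsWalk u w v)
    × (∀ v w → IsWalk v w v → Homotopic w [])

  Finite : Set → Set
  Finite A = ∃[ L ] (∀ (a : A) → a ∈ L)

  -- S(Q) is a sphere iff it is a compact connected surface without boundary
  -- which is simply connected
  IsSphere : Set
  IsSphere = Finite Q₀ × Finite Q₁ × Finite Q₂cc × Finite Q₂cl
             × (∀ α → Internal α) × SimplyConnected

  -- path-consistency
  -- r is a "normal form" for the homotopy class of p₀ (paths u → v):
  -- every path p in the class equals r followed by m face-paths, m unique
  Expresses : Q₀ → Q₀ → List Q₁ → List Q₁ → Set
  Expresses u v p₀ r =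
    ∀ p → IsPath u p v → Homotopic (asWalk p) (asWalk p₀) →
      Σ ℕ λ m →
        (∃[ fs ] (length fs ≡ m × All (FacePathAt v) fs × p ≈A (r ++ concat fs)))
        × (∀ m' fs → length fs ≡ m' → All (FacePathAt v) fs → p ≈A (r ++ concat fs) → m' ≡ m)

  PathConsistent : Set
  PathConsistent =
    ∀ u v p₀ → IsPath u p₀ v →
      ∃[ r ] (IsPath u r v × Homotopic (asWalk r) (asWalk p₀) × Minimal r
              × Expresses u v p₀ r
              × (∀ r' → IsPath u r' v → Homotopic (asWalk r') (asWalk p₀) → Minimal r'
                   → Expresses u v p₀ r' → r' ≈A r))

  WeaklyConsistent : Set
  WeaklyConsistent = ¬ IsSphere × PathConsistent

  IsPerfectMatching : (Q₁ → Set) → Set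
  IsPerfectMatching P =
    ∀ f → ∃[ α ] (α ∈ ∂ f × P α × (∀ β → β ∈ ∂ f → P β → β ≡ α))

  HasPerfectMatching : Set₁
  HasPerfectMatching = Σ (Q₁ → Set) IsPerfectMatching

{-# OPTIONS --safe #-}
-- Fix a base vertex v₀ and, for every vertex u, the minimal path r u from v₀ to u; since S(Q)
-- is simply connected, every path v₀ → u lies in its homotopy class.  All face-paths at a
-- vertex are equal in A_Q (connectedness of the incidence graphs) and so commute with arrows.
-- Path-consistency therefore gives r (t α) · α = r (h α) · ω^(w α) for a unique w α ∈ ℕ, and
-- going around a face f from its vertex c yields r c · ∂ f = r c · ω^(Σ_{α ∈ f} w α).  As also
-- r c · ∂ f = r c · ω, uniqueness of the exponent gives Σ_{α ∈ f} w α = 1: the arrows of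
-- weight 1 form a perfect matching.
module Submission where

open import Defs
open import Data.Nat using (ℕ; zero; suc; _+_)
open import Data.Nat.Properties using (+-comm; suc-injective; m+n≡0⇒m≡0; m+n≡0⇒n≡0)
open import Data.Nat.ListAction using (sum)
open import Data.Bool using (true; false; not)
open import Data.Bool.Properties using (not-involutive)
open import Data.List using (List; []; _∷_; _++_; concat; length; map)
open import Data.List.Properties
  using (++-assoc; ++-identityʳ; ∷-injective; ∷-injectiveʳ; ++-conicalˡ; ++-conicalʳ; concat-++; length-++; unfold-reverse)
open import Data.List.Membership.Propositional using (_∈_)
open import Data.List.Membership.Propositional.Properties using (∈-∃++; ∈-++⁺ʳ)
open import Data.List.Relation.Unary.All using (All; []; _∷_)
open import Data.List.Relation.Unary.All.Properties using (++⁺)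
open import Data.List.Relation.Unary.Any using (here; there)
open import Data.List.Relation.Unary.Unique.Propositional using (Unique)
open import Data.List.Relation.Unary.Unique.Propositional.Properties using (Unique[x∷xs]⇒x∉xs)
open import Data.List.Relation.Unary.AllPairs using (_∷_)
open import Data.Product using (Σ; Σ-syntax; ∃-syntax; _×_; _,_; proj₁; proj₂; map₁)
open import Data.Sum using (inj₁; inj₂)
open import Data.Empty using (⊥-elim)
open import Relation.Nullary using (contradiction)
open import Relation.Binary.PropositionalEquality using (_≡_; refl; sym; trans; cong; cong₂; subst)
open import Relation.Binary.Construct.Closure.Equivalence using (EqClosure; gmap; setoid)
open import Relation.Binary.Construct.Closure.ReflexiveTransitive using (ε; _◅_; _◅◅_)
open import Relation.Binary.Construct.Closure.Symmetric using (fwd; bwd)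
import Relation.Binary.Reasoning.Setoid as SetoidReasoning

module _ {A : Set} where

  infix-++ˡ : ∀ (c : List A) {p} x M y → p ≡ x ++ M ++ y → c ++ p ≡ (c ++ x) ++ M ++ y
  infix-++ˡ c x M y e = trans (cong (c ++_) e) (sym (++-assoc c x (M ++ y)))

  infix-++ʳ : ∀ (d : List A) {p} x M y → p ≡ x ++ M ++ y → p ++ d ≡ x ++ M ++ (y ++ d)
  infix-++ʳ d x M y e =
    trans (cong (_++ d) e) (trans (++-assoc x (M ++ y) d) (cong (x ++_) (++-assoc M y d)))

  Unique-split-unique : ∀ xs xs' {ys ys' : List A} {β} → Unique (xs ++ β ∷ ys) →
    xs ++ β ∷ ys ≡ xs' ++ β ∷ ys' → xs ≡ xs' × ys ≡ ys'
  Unique-split-unique [] [] _ eq = refl , ∷-injectiveʳ eq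
  Unique-split-unique [] (x' ∷ xs') u eq with ∷-injective eq
  ... | refl , e = contradiction (subst (_ ∈_) (sym e) (∈-++⁺ʳ xs' (here refl))) (Unique[x∷xs]⇒x∉xs u)
  Unique-split-unique (x ∷ xs) [] u eq with ∷-injective eq
  ... | refl , _ = contradiction (∈-++⁺ʳ xs (here refl)) (Unique[x∷xs]⇒x∉xs u)
  Unique-split-unique (x ∷ xs) (x' ∷ xs') (_ ∷ u) eq with ∷-injective eq
  ... | refl , e = map₁ (cong (x ∷_)) (Unique-split-unique xs xs' u e)

  sum≡0⇒≡0 : ∀ (k : A → ℕ) l → sum (map k l) ≡ 0 → ∀ {β} → β ∈ l → k β ≡ 0
  sum≡0⇒≡0 k (a ∷ l) s (here refl) = m+n≡0⇒m≡0 (k a) s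
  sum≡0⇒≡0 k (a ∷ l) s (there β∈l) = sum≡0⇒≡0 k l (m+n≡0⇒n≡0 (k a) s) β∈l

  sum≡1⇒∃!≡1 : ∀ (k : A → ℕ) l → sum (map k l) ≡ 1 →
    ∃[ α ] (α ∈ l × k α ≡ 1 × (∀ β → β ∈ l → k β ≡ 1 → β ≡ α))
  sum≡1⇒∃!≡1 k (a ∷ l) s with k a in ka
  ... | zero with sum≡1⇒∃!≡1 k l s
  ...   | α , α∈l , kα , unique = α , there α∈l , kα , λ
          { _ (here refl) kβ → contradiction (trans (sym ka) kβ) λ ()
          ; β (there β∈l) kβ → unique β β∈l kβ }
  sum≡1⇒∃!≡1 k (a ∷ l) s | suc zero = a , here refl , ka , λ
          { _ (here refl) _ → refl
          ; β (there β∈l) kβ → contradiction (trans (sym kβ) (sum≡0⇒≡0 k l (suc-injective s) β∈l)) λ () }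

module _ (Q : QuiverWithFaces) where
  open QuiverWithFaces Q

  infix 4 _≈_
  _≈_ : List Q₁ → List Q₁ → Set
  _≈_ = _≈A_ Q

  module ≈-Reasoning = SetoidReasoning (setoid (AStep Q))

  ≡⇒≈ : ∀ {p q} → p ≡ q → p ≈ q
  ≡⇒≈ refl = ε

  ≈-++⁺ˡ : ∀ c {p q} → p ≈ q → c ++ p ≈ c ++ q
  ≈-++⁺ˡ c = gmap (c ++_) λ { (x , y , r , s , rel , e₁ , e₂) →
    c ++ x , y , r , s , rel , infix-++ˡ c x r y e₁ , infix-++ˡ c x s y e₂ }

  ≈-++⁺ʳ : ∀ d {p q} → p ≈ q → p ++ d ≈ q ++ d
  ≈-++⁺ʳ d = gmap (_++ d) λ { (x , y , r , s , rel , e₁ , e₂) →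
    x , y ++ d , r , s , rel , infix-++ʳ d x r y e₁ , infix-++ʳ d x s y e₂ }

  IsPath-++ : ∀ {a b c p q} → IsPath Q a p b → IsPath Q b q c → IsPath Q a (p ++ q) c
  IsPath-++ nil pq = pq
  IsPath-++ (cons a pp) pq = cons a (IsPath-++ pp pq)

  IsPath-++⁻ : ∀ p {q a c} → IsPath Q a (p ++ q) c → ∃[ b ] (IsPath Q a p b × IsPath Q b q c)
  IsPath-++⁻ [] pq = _ , nil , pq
  IsPath-++⁻ (x ∷ p) (cons .x pq) with IsPath-++⁻ p pq
  ... | b , pp , qq = b , cons x pp , qq

  Rot-refl : ∀ l → Rot Q l l
  Rot-refl l = [] , l , refl , sym (++-identityʳ l)

  Rot-[] : ∀ {l} → Rot Q l [] → l ≡ []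
  Rot-[] (xs , ys , refl , e) = cong₂ _++_ (++-conicalʳ ys xs (sym e)) (++-conicalˡ ys xs (sym e))

  Rot-∷⁻ : ∀ {l β R} → Rot Q l (β ∷ R) → ∃[ xs ] ∃[ ys ] (l ≡ xs ++ β ∷ ys × R ≡ ys ++ xs)
  Rot-∷⁻ {R = R} (xs , [] , e , refl) = [] , R , trans e (++-identityʳ _) , sym (++-identityʳ R)
  Rot-∷⁻ (xs , y ∷ ys , e , refl) = xs , ys , e , refl

  Rot-∷⇒∈ : ∀ {l β R} → Rot Q l (β ∷ R) → β ∈ l
  Rot-∷⇒∈ rot with Rot-∷⁻ rot
  ... | xs , ys , refl , _ = ∈-++⁺ʳ xs (here refl)

  ∈⇒Rot-∷ : ∀ {l β} → β ∈ l → ∃[ R ] Rot Q l (β ∷ R)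
  ∈⇒Rot-∷ β∈l with ∈-∃++ β∈l
  ... | ys , zs , e = zs ++ ys , ys , _ ∷ zs , e , refl

  Rot-rotate : ∀ {l β R} → Rot Q l (β ∷ R) → Rot Q l (R ++ β ∷ [])
  Rot-rotate {β = β} rot with Rot-∷⁻ rot
  ... | xs , ys , refl , refl = xs ++ β ∷ [] , ys , sym (++-assoc xs (β ∷ []) ys) , ++-assoc ys xs (β ∷ [])

  Rot-IsPath : ∀ {l l' v} → IsPath Q v l v → Rot Q l l' → ∃[ w ] IsPath Q w l' w
  Rot-IsPath pl (xs , ys , refl , refl) with IsPath-++⁻ xs pl
  ... | _ , pxs , pys = _ , IsPath-++ pys pxs

  Unique⇒Rot-∷-tail : ∀ {l β R R'} → Unique l → Rot Q l (β ∷ R) → Rot Q l (β ∷ R') → R ≡ R'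
  Unique⇒Rot-∷-tail u rot rot' with Rot-∷⁻ rot | Rot-∷⁻ rot'
  ... | xs , ys , refl , refl | xs' , ys' , e , refl with Unique-split-unique xs xs' u e
  ... | refl , refl = refl

  Decomposes : Q₀ → List Q₁ → ℕ → List Q₁ → Set
  Decomposes v r m p = ∃[ fs ] (length fs ≡ m × All (FacePathAt Q v) fs × p ≈ r ++ concat fs)

  Decomposes-single : ∀ {v r F} → FacePathAt Q v F → Decomposes v r 1 (r ++ F)
  Decomposes-single {r = r} {F} fp = F ∷ [] , refl , fp ∷ [] , ≡⇒≈ (cong (r ++_) (sym (++-identityʳ F)))

  Decomposes-trans : ∀ {v r r' m n p} → Decomposes v r m p → Decomposes v r' n r → Decomposes v r' (n + m) p
  Decomposes-trans {r = r} {r'} {p = p} (fs , refl , fs-at , p≈) (gs , refl , gs-at , r≈) =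
    gs ++ fs , length-++ gs , ++⁺ gs-at fs-at , (begin
      p                              ≈⟨ p≈ ⟩
      r ++ concat fs                 ≈⟨ ≈-++⁺ʳ (concat fs) r≈ ⟩
      (r' ++ concat gs) ++ concat fs ≡⟨ ++-assoc r' (concat gs) (concat fs) ⟩
      r' ++ concat gs ++ concat fs   ≡⟨ cong (r' ++_) (concat-++ gs fs) ⟩
      r' ++ concat (gs ++ fs)        ∎)
    where open ≈-Reasoning

  Homotopic-++⁺ˡ : ∀ c {p q} → Homotopic Q p q → Homotopic Q (c ++ p) (c ++ q)
  Homotopic-++⁺ˡ c = gmap (c ++_) λ
    { (inj₁ (x , y , a , b , e₁ , e₂)) →
        inj₁ (c ++ x , y , a , b , infix-++ˡ c x _ y e₁ , infix-++ˡ c x [] y e₂)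
    ; (inj₂ (inj₁ (x , y , F , fp , e₁ , e₂))) →
        inj₂ (inj₁ (c ++ x , y , F , fp , infix-++ˡ c x _ y e₁ , infix-++ˡ c x [] y e₂))
    ; (inj₂ (inj₂ (x , y , F , fp , e₁ , e₂))) →
        inj₂ (inj₂ (c ++ x , y , F , fp , infix-++ˡ c x _ y e₁ , infix-++ˡ c x [] y e₂)) }

  Homotopic-++⁺ʳ : ∀ d {p q} → Homotopic Q p q → Homotopic Q (p ++ d) (q ++ d)
  Homotopic-++⁺ʳ d = gmap (_++ d) λ
    { (inj₁ (x , y , a , b , e₁ , e₂)) →
        inj₁ (x , y ++ d , a , b , infix-++ʳ d x _ y e₁ , infix-++ʳ d x [] y e₂)
    ; (inj₂ (inj₁ (x , y , F , fp , e₁ , e₂))) →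
        inj₂ (inj₁ (x , y ++ d , F , fp , infix-++ʳ d x _ y e₁ , infix-++ʳ d x [] y e₂))
    ; (inj₂ (inj₂ (x , y , F , fp , e₁ , e₂))) →
        inj₂ (inj₂ (x , y ++ d , F , fp , infix-++ʳ d x _ y e₁ , infix-++ʳ d x [] y e₂)) }

  inverseWalk-cancel : ∀ w → Homotopic Q (inverseWalk Q w ++ w) []
  inverseWalk-cancel [] = ε
  inverseWalk-cancel ((a , b) ∷ w) =
    ≡⇒Homotopic backtrack ◅◅ (fwd (inj₁ (w⁻¹ , w , a , not b , refl , refl)) ◅ inverseWalk-cancel w)
    where
      w⁻¹ = inverseWalk Q w
      ≡⇒Homotopic : ∀ {p q} → p ≡ q → Homotopic Q p q
      ≡⇒Homotopic refl = ε
      backtrack : inverseWalk Q ((a , b) ∷ w) ++ (a , b) ∷ w ≡ w⁻¹ ++ (a , not b) ∷ (a , not (not b)) ∷ w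
      backtrack = trans (cong (_++ (a , b) ∷ w) (unfold-reverse (a , not b) (map (flipStep Q) w)))
        (trans (++-assoc w⁻¹ ((a , not b) ∷ []) ((a , b) ∷ w))
          (cong (λ b' → w⁻¹ ++ (a , not b) ∷ (a , b') ∷ w) (sym (not-involutive b))))

  IsWalk-++ : ∀ {a b c w w'} → IsWalk Q a w b → IsWalk Q b w' c → IsWalk Q a (w ++ w') c
  IsWalk-++ nil q = q
  IsWalk-++ (fwd a p) q = fwd a (IsWalk-++ p q)
  IsWalk-++ (bwd a p) q = bwd a (IsWalk-++ p q)

  IsPath⇒IsWalk : ∀ {a b p} → IsPath Q a p b → IsWalk Q a (asWalk Q p) b
  IsPath⇒IsWalk nil = nil
  IsPath⇒IsWalk (cons a p) = fwd a (IsPath⇒IsWalk p)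

  IsWalk-inverse : ∀ {a b w} → IsWalk Q a w b → IsWalk Q b (inverseWalk Q w) a
  IsWalk-inverse nil = nil
  IsWalk-inverse (fwd a {w} p) =
    subst (λ w⁻¹ → IsWalk Q _ w⁻¹ _) (sym (unfold-reverse (a , false) (map (flipStep Q) w)))
      (IsWalk-++ (IsWalk-inverse p) (bwd a nil))
  IsWalk-inverse (bwd a {w} p) =
    subst (λ w⁻¹ → IsWalk Q _ w⁻¹ _) (sym (unfold-reverse (a , true) (map (flipStep Q) w)))
      (IsWalk-++ (IsWalk-inverse p) (fwd a nil))

  SimplyConnected⇒paths-homotopic : SimplyConnected Q → ∀ {a b p q} →
    IsPath Q a p b → IsPath Q a q b → Homotopic Q (asWalk Q p) (asWalk Q q)
  SimplyConnected⇒paths-homotopic (_ , _ , loops-null) {p = p} {q} pp pq = begin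
    P                   ≡⟨ ++-identityʳ P ⟨
    P ++ []             ≈⟨ Homotopic-++⁺ˡ P (inverseWalk-cancel W) ⟨
    P ++ (W⁻¹ ++ W)     ≡⟨ ++-assoc P W⁻¹ W ⟨
    (P ++ W⁻¹) ++ W     ≈⟨ Homotopic-++⁺ʳ W loop-null ⟩
    W                   ∎
    where
      open SetoidReasoning (setoid (HStep Q))
      P = asWalk Q p
      W = asWalk Q q
      W⁻¹ = inverseWalk Q W
      loop-null : Homotopic Q (P ++ W⁻¹) []
      loop-null = loops-null _ _ (IsWalk-++ (IsPath⇒IsWalk pp) (IsWalk-inverse (IsPath⇒IsWalk pq)))

  module _ (DM : IsDimerModel Q) where
    open IsDimerModel DM

    face-IsPath : ∀ f → ∃[ v ] IsPath Q v (∂ Q f) v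
    face-IsPath f = proj₂ (proj₁ (face-cycle f))

    FacePathAt-starting-with : ∀ β → ∃[ R ] FacePathAt Q (t β) (β ∷ R)
    FacePathAt-starting-with β with in-some-face β
    ... | f , β∈f with ∈⇒Rot-∷ β∈f
    ... | R , rot with Rot-IsPath (proj₂ (face-IsPath f)) rot
    ... | _ , pβR@(cons _ _) = R , (f , rot) , pβR

    FacePathAt-rotate : ∀ {β R} → FacePathAt Q (t β) (β ∷ R) → FacePathAt Q (h β) (R ++ β ∷ [])
    FacePathAt-rotate {β} ((f , rot) , cons _ pR) = (f , Rot-rotate rot) , IsPath-++ pR (cons β nil)

    IsWalk⇒IsPath : ∀ {a b w} → IsWalk Q a w b → ∃[ p ] IsPath Q a p b
    IsWalk⇒IsPath nil = [] , nil
    IsWalk⇒IsPath (fwd α w) with IsWalk⇒IsPath w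
    ... | p , pp = α ∷ p , cons α pp
    IsWalk⇒IsPath (bwd α w) with IsWalk⇒IsPath w | FacePathAt-starting-with α
    ... | p , pp | R , _ , cons _ pR = R ++ p , IsPath-++ pR pp

    face-tails-≈ : ∀ f f' {β R R'} → Rot Q (∂ Q f) (β ∷ R) → Rot Q (∂ Q f') (β ∷ R') → R ≈ R'
    face-tails-≈ (inj₁ f) (inj₁ f') rot rot' with cc-unique _ f f' (Rot-∷⇒∈ rot) (Rot-∷⇒∈ rot')
    ... | refl = ≡⇒≈ (Unique⇒Rot-∷-tail (proj₂ (face-cycle (inj₁ f))) rot rot')
    face-tails-≈ (inj₂ f) (inj₂ f') rot rot' with cl-unique _ f f' (Rot-∷⇒∈ rot) (Rot-∷⇒∈ rot')
    ... | refl = ≡⇒≈ (Unique⇒Rot-∷-tail (proj₂ (face-cycle (inj₂ f))) rot rot')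
    face-tails-≈ (inj₁ f) (inj₂ g) {β} {R} {R'} rot rot' =
      fwd ([] , [] , R , R' , (β , f , g , rot , rot') , sym (++-identityʳ R) , sym (++-identityʳ R')) ◅ ε
    face-tails-≈ (inj₂ g) (inj₁ f) {β} {R} {R'} rot rot' =
      bwd ([] , [] , R' , R , (β , f , g , rot' , rot) , sym (++-identityʳ R') , sym (++-identityʳ R)) ◅ ε

    FacePathThrough : ∀ {a} → Inc Q a → List Q₁ → Set
    FacePathThrough (inj₂ (β , _)) G = ∃[ f ] ∃[ R ] (Rot Q (∂ Q f) (β ∷ R) × G ≡ β ∷ R)
    FacePathThrough (inj₁ (α , _)) G = ∃[ f ] ∃[ R ] (Rot Q (∂ Q f) (α ∷ R) × G ≡ R ++ α ∷ [])

    FacePathThrough-≈ : ∀ {a} (x : Inc Q a) {G G'} → FacePathThrough x G → FacePathThrough x G' → G ≈ G'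
    FacePathThrough-≈ (inj₂ (β , _)) (f , _ , rot , refl) (f' , _ , rot' , refl) =
      ≈-++⁺ˡ (β ∷ []) (face-tails-≈ f f' rot rot')
    FacePathThrough-≈ (inj₁ (α , _)) (f , _ , rot , refl) (f' , _ , rot' , refl) =
      ≈-++⁺ʳ (α ∷ []) (face-tails-≈ f f' rot rot')

    IncEdge⇒FacePathThrough : ∀ {a} (x y : Inc Q a) → IncEdge Q a x y →
      ∃[ G ] (FacePathThrough x G × FacePathThrough y G)
    IncEdge⇒FacePathThrough (inj₁ (α , _)) (inj₂ (β , _)) (f , r , s , rot , αr≡βs) =
      r ++ α ∷ [] , (f , r , rot , refl) , (f , s , subst (Rot Q (∂ Q f)) αr≡βs (Rot-rotate rot) , αr≡βs)

    EqClosure-IncEdge⇒≈ : ∀ {a} {x y : Inc Q a} → EqClosure (IncEdge Q a) x y →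
      ∀ {G G'} → FacePathThrough x G → FacePathThrough y G' → G ≈ G'
    EqClosure-IncEdge⇒≈ {x = x} ε Gx G'x = FacePathThrough-≈ x Gx G'x
    EqClosure-IncEdge⇒≈ {x = x} (fwd e ◅ xs) Gx G'y with IncEdge⇒FacePathThrough _ _ e
    ... | _ , Ex , Ez = FacePathThrough-≈ x Gx Ex ◅◅ EqClosure-IncEdge⇒≈ xs Ez G'y
    EqClosure-IncEdge⇒≈ {x = x} (bwd e ◅ xs) Gx G'y with IncEdge⇒FacePathThrough _ _ e
    ... | _ , Ez , Ex = FacePathThrough-≈ x Gx Ex ◅◅ EqClosure-IncEdge⇒≈ xs Ez G'y

    FacePathAt⇒FacePathThrough : ∀ {a G} → FacePathAt Q a G → Σ[ x ∈ Inc Q a ] FacePathThrough x G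
    FacePathAt⇒FacePathThrough {G = []} ((f , rot) , _) = ⊥-elim (proj₁ (proj₁ (face-cycle f)) (Rot-[] rot))
    FacePathAt⇒FacePathThrough {G = γ ∷ R} ((f , rot) , cons _ _) = inj₂ (γ , refl) , f , R , rot , refl

    -- Face-paths with the same first (or last) arrow are equal by a relation R^cc = R^cl, and
    -- consecutive arrows of a face join these classes along the connected incidence graph.
    FacePathAt-≈ : ∀ {a G G'} → FacePathAt Q a G → FacePathAt Q a G' → G ≈ G'
    FacePathAt-≈ {a} fp fp' with FacePathAt⇒FacePathThrough fp | FacePathAt⇒FacePathThrough fp'
    ... | x , Gx | y , G'y = EqClosure-IncEdge⇒≈ (inc-connected a x y) Gx G'y

    FacePathAt-++-arrow : ∀ {β G} → FacePathAt Q (t β) G →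
      ∃[ G' ] (FacePathAt Q (h β) G' × G ++ β ∷ [] ≈ β ∷ G')
    FacePathAt-++-arrow {β} fp with FacePathAt-starting-with β
    ... | R , fpβ = R ++ β ∷ [] , FacePathAt-rotate fpβ , ≈-++⁺ʳ (β ∷ []) (FacePathAt-≈ fp fpβ)

    FacePathAt-++-path : ∀ {a b G q} → FacePathAt Q a G → IsPath Q a q b →
      ∃[ G' ] (FacePathAt Q b G' × G ++ q ≈ q ++ G')
    FacePathAt-++-path {G = G} fp nil = G , fp , ≡⇒≈ (++-identityʳ G)
    FacePathAt-++-path {G = G} fp (cons β {q} pq) with FacePathAt-++-arrow fp
    ... | G₁ , fp₁ , G≈ with FacePathAt-++-path fp₁ pq
    ... | G₂ , fp₂ , G₁≈ = G₂ , fp₂ , (begin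
      G ++ β ∷ q            ≡⟨ ++-assoc G (β ∷ []) q ⟨
      (G ++ β ∷ []) ++ q    ≈⟨ ≈-++⁺ʳ q G≈ ⟩
      β ∷ G₁ ++ q           ≈⟨ ≈-++⁺ˡ (β ∷ []) G₁≈ ⟩
      β ∷ q ++ G₂           ∎)
      where open ≈-Reasoning

    FacePathsAt-++-path : ∀ {a b q} fs → All (FacePathAt Q a) fs → IsPath Q a q b →
      ∃[ fs' ] (length fs' ≡ length fs × All (FacePathAt Q b) fs' × concat fs ++ q ≈ q ++ concat fs')
    FacePathsAt-++-path {q = q} [] [] pq = [] , refl , [] , ≡⇒≈ (sym (++-identityʳ q))
    FacePathsAt-++-path {q = q} (G ∷ fs) (fp ∷ fps) pq
      with FacePathsAt-++-path fs fps pq | FacePathAt-++-path fp pq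
    ... | fs' , len , fs'-at , fs≈ | G' , fp' , G≈ = G' ∷ fs' , cong suc len , fp' ∷ fs'-at , (begin
      (G ++ concat fs) ++ q     ≡⟨ ++-assoc G (concat fs) q ⟩
      G ++ concat fs ++ q       ≈⟨ ≈-++⁺ˡ G fs≈ ⟩
      G ++ q ++ concat fs'      ≡⟨ ++-assoc G q (concat fs') ⟨
      (G ++ q) ++ concat fs'    ≈⟨ ≈-++⁺ʳ (concat fs') G≈ ⟩
      (q ++ G') ++ concat fs'   ≡⟨ ++-assoc q G' (concat fs') ⟩
      q ++ G' ++ concat fs'     ∎)
      where open ≈-Reasoning

    Decomposes-++ : ∀ {a b r m p q} → Decomposes a r m p → IsPath Q a q b → Decomposes b (r ++ q) m (p ++ q)
    Decomposes-++ {r = r} {p = p} {q} (fs , len , fs-at , p≈) pq with FacePathsAt-++-path fs fs-at pq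
    ... | fs' , len' , fs'-at , fs≈ = fs' , trans len' len , fs'-at , (begin
      p ++ q                    ≈⟨ ≈-++⁺ʳ q p≈ ⟩
      (r ++ concat fs) ++ q     ≡⟨ ++-assoc r (concat fs) q ⟩
      r ++ concat fs ++ q       ≈⟨ ≈-++⁺ˡ r fs≈ ⟩
      r ++ q ++ concat fs'      ≡⟨ ++-assoc r q (concat fs') ⟨
      (r ++ q) ++ concat fs'    ∎)
      where open ≈-Reasoning

    module Weights (SC : SimplyConnected Q) (PC : PathConsistent Q) where

      base : Q₀
      base = proj₁ (proj₁ SC)

      reference : ∀ u → ∃[ p ] IsPath Q base p u
      reference u = IsWalk⇒IsPath (proj₂ (proj₁ (proj₂ SC) base u))

      minimal : Q₀ → List Q₁
      minimal u = proj₁ (PC base u _ (proj₂ (reference u)))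

      minimal-IsPath : ∀ u → IsPath Q base (minimal u) u
      minimal-IsPath u = proj₁ (proj₂ (PC base u _ (proj₂ (reference u))))

      minimal-Expresses : ∀ u → Expresses Q base u (proj₁ (reference u)) (minimal u)
      minimal-Expresses u = proj₁ (proj₂ (proj₂ (proj₂ (proj₂ (PC base u _ (proj₂ (reference u)))))))

      normal-form : ∀ {u p} → IsPath Q base p u →
        Σ ℕ λ m → Decomposes u (minimal u) m p × (∀ {n} → Decomposes u (minimal u) n p → n ≡ m)
      normal-form {u} pp
        with minimal-Expresses u _ pp (SimplyConnected⇒paths-homotopic SC pp (proj₂ (reference u)))
      ... | m , d , unique = m , d , λ (fs , len , fs-at , p≈) → unique _ fs len fs-at p≈

      weight : Q₁ → ℕ
      weight α = proj₁ (normal-form (IsPath-++ (minimal-IsPath (t α)) (cons α nil)))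

      weight-Decomposes : ∀ α → Decomposes (h α) (minimal (h α)) (weight α) (minimal (t α) ++ α ∷ [])
      weight-Decomposes α = proj₁ (proj₂ (normal-form (IsPath-++ (minimal-IsPath (t α)) (cons α nil))))

      path-weight : ∀ {a b q} → IsPath Q a q b →
        Decomposes b (minimal b) (sum (map weight q)) (minimal a ++ q)
      path-weight nil = [] , refl , [] , ε
      path-weight {b = b} (cons α {q} pq) =
        subst (λ m → Decomposes b (minimal b) m (minimal (t α) ++ α ∷ q))
              (+-comm (sum (map weight q)) (weight α))
          (subst (Decomposes b (minimal b) _) (++-assoc (minimal (t α)) (α ∷ []) q)
            (Decomposes-trans (Decomposes-++ (weight-Decomposes α) pq) (path-weight pq)))

      face-weight≡1 : ∀ f → sum (map weight (∂ Q f)) ≡ 1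
      face-weight≡1 f with face-IsPath f
      ... | c , cyc with normal-form (IsPath-++ (minimal-IsPath c) cyc)
      ... | _ , _ , unique =
        trans (unique (path-weight cyc)) (sym (unique (Decomposes-single ((f , Rot-refl (∂ Q f)) , cyc))))

theorem6p7 : (Q : QuiverWithFaces) → IsDimerModel Q → SimplyConnected Q →
    WeaklyConsistent Q → HasPerfectMatching Q
theorem6p7 Q DM SC (_ , PC) =
  (λ α → weight α ≡ 1) , λ f → sum≡1⇒∃!≡1 weight (∂ Q f) (face-weight≡1 f)
  where
    open Weights Q DM SC PC
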